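{- Let $n\geq 4$. Among all unicyclic graphs on $n$ vertices, the pineapple graph $U_{n,3}^p$ has the maximum core index; that is, $F(G)\leq F(U_{n,3}^p)$ for every unicyclic graph $G$ on $n$ vertices.
   Context: All graphs are finite, simple and undirected. A unicyclic graph is a connected graph with the same number of vertices and edges. The pineapple graph $U_{n,3}^p$ is obtained from a triangle $C_3$ by attaching $n-3$ new pendant vertices to a single vertex of the triangle. A connected subgraph of a graph $G=(V,E)$ is a graph $(V',E')$ with $\emptyset\neq V'\subseteq V$, $E'\subseteq E$, every edge of $E'$ having both endpoints in $V'$, and $(V',E')$ connected; distinct pairs $(V',E')$ are counted separately. The core index $F(G)$ is the number of connected subgraphs of $G$. -}

module Defs where

open import Data.Nat using (ℕ; zero; suc; _+_; _<_; _≤_)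
open import Data.Nat.Properties using (_<?_)
open import Data.Fin using (Fin; toℕ; _≟_)
open import Data.Bool using (Bool; true; false; _∧_; _∨_; if_then_else_)
open import Data.Vec using (Vec; lookup)
open import Data.List using (List; map; allFin)
open import Data.Nat.ListAction using (sum)
open import Data.Bool.Properties using (∨-comm; ∧-comm)
open import Relation.Nullary using (yes; no)
open import Relation.Binary.PropositionalEquality using (refl; cong; cong₂; sym; trans)
open import Data.Empty using (⊥-elim)
open import Data.Product using (Σ; ∃; _×_; proj₁; proj₂)
open import Relation.Nullary.Decidable using (⌊_⌋)
open import Relation.Binary.PropositionalEquality using (_≡_)

record Graph (n : ℕ) : Set where
  field
    adj    : Fin n → Fin n → Bool
    adj-sym    : ∀ i j → adj i j ≡ adj j i
    adj-irrefl : ∀ i → adj i i ≡ false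
open Graph public

data Walk {n : ℕ} (A : Fin n → Fin n → Set) : Fin n → Fin n → Set where
  here : ∀ {u} → Walk A u u
  step : ∀ {u v w} → A u v → Walk A v w → Walk A u w

Connected : ∀ {n} → Graph n → Set
Connected {n} G = ∀ (u v : Fin n) → Walk (λ a b → adj G a b ≡ true) u v

numEdges : ∀ {n} → Graph n → ℕ
numEdges {n} G =
  sum (map (λ i → sum (map (λ j →
    if ⌊ toℕ i <? toℕ j ⌋ ∧ adj G i j then 1 else 0) (allFin n))) (allFin n))

Unicyclic : ∀ {n} → Graph n → Set
Unicyclic {n} G = Connected G × numEdges G ≡ n

-- Pineapple graph U^p_{n,3}: triangle on vertices 0,1,2, and the
-- remaining n-3 vertices are pendant vertices attached to vertex 0.
isZ : ℕ → Bool
isZ zero = true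
isZ (suc _) = false

isOneTwo : ℕ → Bool
isOneTwo 1 = true
isOneTwo 2 = true
isOneTwo _ = false

pineRel : ℕ → ℕ → Bool
pineRel a b = isZ a ∨ isZ b ∨ (isOneTwo a ∧ isOneTwo b)

pineRel-sym : ∀ a b → pineRel a b ≡ pineRel b a
pineRel-sym a b with isZ a | isZ b
... | true  | true  = refl
... | true  | false = refl
... | false | true  = refl
... | false | false = ∧-comm (isOneTwo a) (isOneTwo b)

pineAdj : ∀ {n} → Fin n → Fin n → Bool
pineAdj i j with i ≟ j
... | yes _ = false
... | no _  = pineRel (toℕ i) (toℕ j)

pineAdj-irrefl : ∀ {n} (i : Fin n) → pineAdj i i ≡ false
pineAdj-irrefl i with i ≟ i
... | yes _ = refl
... | no ¬p = ⊥-elim (¬p refl)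

pineAdj-sym : ∀ {n} (i j : Fin n) → pineAdj i j ≡ pineAdj j i
pineAdj-sym i j with i ≟ j | j ≟ i
... | yes _ | yes _ = refl
... | yes p | no ¬q = ⊥-elim (¬q (sym p))
... | no ¬p | yes q = ⊥-elim (¬p (sym q))
... | no _  | no _  = pineRel-sym (toℕ i) (toℕ j)

pineapple : (n : ℕ) → Graph n
pineapple n = record { adj = pineAdj ; adj-sym = pineAdj-sym ; adj-irrefl = pineAdj-irrefl }

-- The data of a subgraph (V', E') of a graph on
-- Fin n is a vertex subset V' (a Vec Bool n) and an edge subset E'
-- (a symmetric Boolean matrix; E'[i][j] = true means the edge ij is in E').
SubData : ℕ → Set
SubData n = Vec Bool n × Vec (Vec Bool n) n

record IsConnSub {n : ℕ} (G : Graph n) (S : SubData n) : Set where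
  V' : Fin n → Bool
  V' i = lookup (proj₁ S) i
  E' : Fin n → Fin n → Bool
  E' i j = lookup (lookup (proj₂ S) i) j
  field
    nonempty  : ∃ λ i → V' i ≡ true
    E'-sym    : ∀ i j → E' i j ≡ E' j i
    E'⊆E      : ∀ i j → E' i j ≡ true → adj G i j ≡ true
    E'-ends   : ∀ i j → E' i j ≡ true → V' i ≡ true × V' j ≡ true
    connected : ∀ u v → V' u ≡ true → V' v ≡ true →
                Walk (λ a b → E' a b ≡ true) u v

ConnSub : ∀ {n} → Graph n → Set
ConnSub {n} G = Σ (SubData n) (IsConnSub G)

-- F(G) ≤ F(H): the set of connected subgraphs (V', E') of G injects into
-- that of H (injectivity measured on the subgraph data (V', E') only).
_≤F_ : ∀ {n m} → Graph n → Graph m → Set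
G ≤F H = Σ (ConnSub G → ConnSub H) λ f →
  ∀ x y → proj₁ (f x) ≡ proj₁ (f y) → proj₁ x ≡ proj₁ y

-- A connected subgraph without edges is a single vertex, and any other one is
-- determined by its edge set, which is nonempty and connected.  So it suffices to encode the
-- connected edge sets of a unicyclic graph on n = 3 + k vertices injectively by those of the
-- pineapple, i.e. by n-bit codes (one bit per pineapple edge) other than "edge 12 plus some
-- pendant edges".  This is done by induction, deleting leaves until a cycle remains.  On a cycle
-- x′–0–y–y′–…, the edges 0x′, yy′, 0y go to the triangle edges 01, 02, 12 and every other edge to
-- a pendant edge; a connected edge set containing 0y but neither 0x′ nor yy′ is {0y}, so no bad
-- code arises.  Putting back a leaf v at u adds a pendant bit for vu; the one code that cannot
-- take it, that of {12}, is exchanged for the code of a single edge avoiding u, which no edge set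
-- touching u uses.

{-# OPTIONS --safe #-}
module Submission where

open import Defs
open import Data.Nat using (ℕ; zero; suc; pred; _+_; _≤_; _<_; z≤n; s≤s; _<?_; ⌊_/2⌋)
import Data.Nat as ℕ
open import Data.Nat.Properties
  using (+-0-commutativeMonoid; +-mono-≤; +-monoʳ-≤; +-cancelʳ-≤; ≤-antisym; ≤-reflexive;
         +-suc; +-identityʳ; 1+n≢0; <-cmp; n≡⌊n+n/2⌋; module ≤-Reasoning)
open import Data.Nat.Solver using (module +-*-Solver)
open import Data.Nat.ListAction using () renaming (sum to listSum)
open import Algebra.Properties.CommutativeMonoid.Sum +-0-commutativeMonoid
  using (sum; sum-syntax; sum-remove; sum-cong-≗; ∑-distrib-+; ∑-comm)
open import Data.Fin using (Fin; zero; suc; toℕ; punchIn; punchOut; _≟_)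
open import Data.Fin.Patterns using (0F; 1F; 2F)
open import Data.Fin.Properties
  using (toℕ-injective; suc-injective; punchInᵢ≢i; punchIn-punchOut; punchIn-injective; any?)
open import Data.Bool using (Bool; true; false; T; _∧_; _∨_; if_then_else_)
import Data.Bool as Bool
open import Data.Bool.Properties
  using (¬-not; not-¬; T-≡; T-∧; T-∨; ∧-comm; ∨-comm; ∨-identityʳ; ⇔→≡)
open import Data.Vec using (Vec; []; _∷_; _++_; lookup; tabulate; replicate)
import Data.Vec as Vec
import Data.Vec.Properties as Vec
open import Data.Vec.Membership.Propositional using (_∈_)
open import Data.Vec.Membership.Propositional.Properties using (∈-map⁺; ∈-++⁺ˡ; ∈-++⁺ʳ)
open import Data.Vec.Relation.Unary.Any using (here; there)
import Data.List as List
import Data.List.Properties as List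
open import Data.Product using (Σ; ∃; ∃₂; _×_; _,_; proj₁; proj₂)
open import Data.Sum using (_⊎_; inj₁; inj₂; [_,_]′)
import Data.Sum as Sum
open import Data.Empty using (⊥-elim)
open import Function using (_∘_; Equivalence; mk⇔)
open import Relation.Binary using (tri<; tri≈; tri>)
open import Relation.Nullary using (Dec; yes; no; ¬_)
open import Relation.Nullary.Decidable
  using (⌊_⌋; fromWitness; toWitness; dec-true; dec-false; isYes≗does)
open import Relation.Binary.PropositionalEquality

-- Counting and finite sums

bit : Bool → ℕ
bit b = if b then 1 else 0

count : ∀ {n} → (Fin n → Bool) → ℕ
count {n} p = ∑[ i < n ] bit (p i)

count-remove : ∀ {n} (p : Fin (suc n) → Bool) (i : Fin (suc n)) →
               count p ≡ bit (p i) + count (p ∘ punchIn i)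
count-remove p i = sum-remove (bit ∘ p)

count≡0⇒false : ∀ {n} (p : Fin n → Bool) → count p ≡ 0 → ∀ i → p i ≡ false
count≡0⇒false {suc n} p c≡0 i = ¬-not λ pi →
  1+n≢0 (trans (cong (λ b → bit b + count (p ∘ punchIn i)) (sym pi))
               (trans (sym (count-remove p i)) c≡0))

count-witness : ∀ {n} (p : Fin n → Bool) → count p ≢ 0 → ∃ λ i → p i ≡ true
count-witness {zero} p c≢0 = ⊥-elim (c≢0 refl)
count-witness {suc n} p c≢0 with p zero in p0
... | true = zero , p0
... | false = let i , pi = count-witness (p ∘ suc) c≢0 in suc i , pi

count≡1⇒unique : ∀ {n} (p : Fin n → Bool) → count p ≡ 1 →
                 ∃ λ u → p u ≡ true × ∀ j → p j ≡ true → j ≡ u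
count≡1⇒unique {suc n} p c≡1 with p zero in p0
... | true = zero , p0 , λ where
  zero _ → refl
  (suc j) pj → ⊥-elim (not-¬ pj (count≡0⇒false (p ∘ suc) (cong pred c≡1) j))
... | false with count≡1⇒unique (p ∘ suc) c≡1
...   | u , pu , unique = suc u , pu , λ where
  zero pj → ⊥-elim (not-¬ pj p0)
  (suc j) pj → cong suc (unique j pj)

count≡2⇒other : ∀ {n} (p : Fin (suc n) → Bool) → count p ≡ 2 → ∀ {a} → p a ≡ true →
                ∃ λ b → b ≢ a × p b ≡ true × ∀ j → p j ≡ true → j ≡ a ⊎ j ≡ b
count≡2⇒other p c≡2 {a} pa =
  let b , pb , unique = count≡1⇒unique (p ∘ punchIn a) rest≡1 in
  punchIn a b , punchInᵢ≢i a b , pb , λ j pj → other j pj unique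
  where
  rest≡1 : count (p ∘ punchIn a) ≡ 1
  rest≡1 = cong pred (trans (cong (λ b → bit b + count (p ∘ punchIn a)) (sym pa))
                            (trans (sym (count-remove p a)) c≡2))
  other : ∀ {b} j → p j ≡ true → (∀ j′ → p (punchIn a j′) ≡ true → j′ ≡ b) → j ≡ a ⊎ j ≡ punchIn a b
  other j pj unique with j ≟ a
  ... | yes j≡a = inj₁ j≡a
  ... | no j≢a = inj₂ (trans (sym (punchIn-punchOut a≢j))
                             (cong (punchIn a) (unique _ (trans (cong p (punchIn-punchOut a≢j)) pj))))
    where
    a≢j : a ≢ j
    a≢j = j≢a ∘ sym

∑-mono-≤ : ∀ {n} {f g : Fin n → ℕ} → (∀ i → f i ≤ g i) → ∑[ i < n ] f i ≤ ∑[ i < n ] g i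
∑-mono-≤ {zero} f≤g = z≤n
∑-mono-≤ {suc n} f≤g = +-mono-≤ (f≤g zero) (∑-mono-≤ (f≤g ∘ suc))

∑-squeeze : ∀ {n} {f g : Fin n → ℕ} → (∀ i → g i ≤ f i) → ∑[ i < n ] f i ≤ ∑[ i < n ] g i →
            ∀ i → f i ≡ g i
∑-squeeze {suc n} {f} {g} g≤f ∑f≤∑g i = ≤-antisym (+-cancelʳ-≤ _ _ _ fi+rest≤gi+rest) (g≤f i)
  where
  fi+rest≤gi+rest : f i + sum (g ∘ punchIn i) ≤ g i + sum (g ∘ punchIn i)
  fi+rest≤gi+rest = begin
    f i + sum (g ∘ punchIn i)   ≤⟨ +-monoʳ-≤ (f i) (∑-mono-≤ (g≤f ∘ punchIn i)) ⟩
    f i + sum (f ∘ punchIn i)   ≡⟨ sum-remove f ⟨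
    sum f                       ≤⟨ ∑f≤∑g ⟩
    sum g                       ≡⟨ sum-remove g ⟩
    g i + sum (g ∘ punchIn i)   ∎
    where open ≤-Reasoning

∑-const-2 : ∀ n → ∑[ i < n ] 2 ≡ n + n
∑-const-2 zero = refl
∑-const-2 (suc n) = cong suc (trans (cong suc (∑-const-2 n)) (sym (+-suc n n)))

listSum-allFin : ∀ {n} (f : Fin n → ℕ) → listSum (List.map f (List.allFin n)) ≡ ∑[ i < n ] f i
listSum-allFin f = trans (cong listSum (List.map-tabulate (λ i → i) f)) (sum-tabulate f)
  where
  sum-tabulate : ∀ {n} (f : Fin n → ℕ) → listSum (List.tabulate f) ≡ ∑[ i < n ] f i
  sum-tabulate {zero} f = refl
  sum-tabulate {suc n} f = cong (f zero +_) (sum-tabulate (f ∘ suc))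

-- Degrees and edge counts

deg : ∀ {n} → Graph n → Fin n → ℕ
deg G v = count (adj G v)

before : ∀ {n} → Fin n → Fin n → Bool
before i j = ⌊ toℕ i <? toℕ j ⌋

edgeCount : ∀ {n} → Graph n → ℕ
edgeCount {n} G = ∑[ i < n ] count (λ j → before i j ∧ adj G i j)

numEdges≡edgeCount : ∀ {n} (G : Graph n) → numEdges G ≡ edgeCount G
numEdges≡edgeCount {n} G =
  trans (listSum-allFin (λ i → listSum (List.map (λ j → bit (before i j ∧ adj G i j)) (List.allFin n))))
        (sum-cong-≗ λ i → listSum-allFin (λ j → bit (before i j ∧ adj G i j)))

before-true : ∀ {n} {i j : Fin n} → toℕ i < toℕ j → before i j ≡ true
before-true {i = i} {j} i<j = trans (isYes≗does (toℕ i <? toℕ j)) (dec-true (toℕ i <? toℕ j) i<j)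

before-false : ∀ {n} {i j : Fin n} → ¬ toℕ i < toℕ j → before i j ≡ false
before-false {i = i} {j} i≮j = trans (isYes≗does (toℕ i <? toℕ j)) (dec-false (toℕ i <? toℕ j) i≮j)

bit-before-split : ∀ {n} (i j : Fin n) (b : Bool) → (i ≡ j → b ≡ false) →
                   bit (before i j ∧ b) + bit (before j i ∧ b) ≡ bit b
bit-before-split i j b i≡j⇒¬b with <-cmp (toℕ i) (toℕ j)
... | tri< i<j _ j≮i rewrite before-true i<j | before-false j≮i = +-identityʳ (bit b)
... | tri> i≮j _ j<i rewrite before-false i≮j | before-true j<i = refl
... | tri≈ i≮j i≡j j≮i rewrite before-false i≮j | before-false j≮i | i≡j⇒¬b (toℕ-injective i≡j) = refl

handshake : ∀ {n} (G : Graph n) → ∑[ v < n ] deg G v ≡ edgeCount G + edgeCount G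
handshake {n} G = begin
  ∑[ i < n ] ∑[ j < n ] bit (a i j)
    ≡⟨ sum-cong-≗ (λ i → sum-cong-≗ λ j → bit-before-split i j (a i j) λ where refl → adj-irrefl G i) ⟨
  ∑[ i < n ] ∑[ j < n ] (bit (before i j ∧ a i j) + bit (before j i ∧ a i j))
    ≡⟨ sum-cong-≗ (λ i → ∑-distrib-+ (λ j → bit (before i j ∧ a i j))
                                     (λ j → bit (before j i ∧ a i j))) ⟩
  ∑[ i < n ] (∑[ j < n ] bit (before i j ∧ a i j) + ∑[ j < n ] bit (before j i ∧ a i j))
    ≡⟨ ∑-distrib-+ (λ i → ∑[ j < n ] bit (before i j ∧ a i j))
                   (λ i → ∑[ j < n ] bit (before j i ∧ a i j)) ⟩
  edgeCount G + ∑[ i < n ] ∑[ j < n ] bit (before j i ∧ a i j)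
    ≡⟨ cong (edgeCount G +_) (∑-comm (λ i j → bit (before j i ∧ a i j))) ⟩
  edgeCount G + ∑[ j < n ] ∑[ i < n ] bit (before j i ∧ a i j)
    ≡⟨ cong (edgeCount G +_) (sum-cong-≗ λ j → sum-cong-≗ λ i →
         cong (λ b → bit (before j i ∧ b)) (adj-sym G i j)) ⟩
  edgeCount G + edgeCount G ∎
  where
  open ≡-Reasoning
  a : Fin n → Fin n → Bool
  a = adj G

deleteVertex : ∀ {n} → Graph (suc n) → Fin (suc n) → Graph n
deleteVertex G v = record
  { adj        = λ i j → adj G (punchIn v i) (punchIn v j)
  ; adj-sym    = λ i j → adj-sym G (punchIn v i) (punchIn v j)
  ; adj-irrefl = λ i → adj-irrefl G (punchIn v i)
  }

edgeCount-deleteVertex : ∀ {n} (G : Graph (suc n)) (v : Fin (suc n)) →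
                         edgeCount G ≡ deg G v + edgeCount (deleteVertex G v)
-- Doubled, both sides are given by the handshake lemma in G and in G − v.
edgeCount-deleteVertex {n} G v = begin
  edgeCount G                                     ≡⟨ n≡⌊n+n/2⌋ _ ⟩
  ⌊ edgeCount G + edgeCount G /2⌋                 ≡⟨ cong ⌊_/2⌋ double ⟩
  ⌊ (d + edgeCount G′) + (d + edgeCount G′) /2⌋   ≡⟨ n≡⌊n+n/2⌋ _ ⟨
  d + edgeCount G′                                ∎
  where
  open ≡-Reasoning
  open +-*-Solver using (solve; _:+_; _:=_)
  G′ : Graph n
  G′ = deleteVertex G v
  d : ℕ
  d = deg G v
  d≡∑arcs : d ≡ ∑[ i < n ] bit (adj G (punchIn v i) v)
  d≡∑arcs = trans (count-remove (adj G v) v)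
                  (trans (cong (λ b → bit b + count (adj G v ∘ punchIn v)) (adj-irrefl G v))
                         (sum-cong-≗ λ i → cong bit (adj-sym G v (punchIn v i))))
  double : edgeCount G + edgeCount G ≡ (d + edgeCount G′) + (d + edgeCount G′)
  double = begin
    edgeCount G + edgeCount G
      ≡⟨ handshake G ⟨
    ∑[ w < suc n ] deg G w
      ≡⟨ sum-remove (deg G) ⟩
    d + ∑[ i < n ] deg G (punchIn v i)
      ≡⟨ cong (d +_) (sum-cong-≗ λ i → count-remove (adj G (punchIn v i)) v) ⟩
    d + ∑[ i < n ] (bit (adj G (punchIn v i) v) + deg G′ i)
      ≡⟨ cong (d +_) (∑-distrib-+ (λ i → bit (adj G (punchIn v i) v)) (deg G′)) ⟩
    d + (∑[ i < n ] bit (adj G (punchIn v i) v) + ∑[ i < n ] deg G′ i)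
      ≡⟨ cong₂ (λ x y → d + (x + y)) (sym d≡∑arcs) (handshake G′) ⟩
    d + (d + (edgeCount G′ + edgeCount G′))
      ≡⟨ solve 2 (λ x y → x :+ (x :+ (y :+ y)) := (x :+ y) :+ (x :+ y)) refl d (edgeCount G′) ⟩
    (d + edgeCount G′) + (d + edgeCount G′)
      ∎

indices : ∀ {n} (p : Fin n → Bool) → Vec (Fin n) (count p)
indices {zero} p = []
indices {suc n} p with p zero
... | true = zero ∷ Vec.map suc (indices (p ∘ suc))
... | false = Vec.map suc (indices (p ∘ suc))

∈-indices : ∀ {n} (p : Fin n → Bool) {i} → p i ≡ true → i ∈ indices p
∈-indices {suc n} p {i} pi with p zero in p0
∈-indices {suc n} p {zero} pi | true = here refl
∈-indices {suc n} p {suc i} pi | true = there (∈-map⁺ suc (∈-indices (p ∘ suc) pi))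
∈-indices {suc n} p {zero} pi | false = ⊥-elim (not-¬ pi p0)
∈-indices {suc n} p {suc i} pi | false = ∈-map⁺ suc (∈-indices (p ∘ suc) pi)

concatAll : ∀ {A : Set} {n} {m : Fin n → ℕ} → ((i : Fin n) → Vec A (m i)) → Vec A (∑[ i < n ] m i)
concatAll {n = zero} xs = []
concatAll {n = suc n} xs = xs zero ++ concatAll (xs ∘ suc)

∈-concatAll : ∀ {A : Set} {n} {m : Fin n → ℕ} (xs : (i : Fin n) → Vec A (m i)) {x} i →
              x ∈ xs i → x ∈ concatAll xs
∈-concatAll {n = suc n} xs zero x∈ = ∈-++⁺ˡ x∈
∈-concatAll {n = suc n} xs (suc i) x∈ = ∈-++⁺ʳ (xs zero) (∈-concatAll (xs ∘ suc) i x∈)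

edgeVec : ∀ {n} (G : Graph n) → Vec (Fin n × Fin n) (edgeCount G)
edgeVec G = concatAll λ i → Vec.map (i ,_) (indices (λ j → before i j ∧ adj G i j))

∈-edgeVec-ordered : ∀ {n} (G : Graph n) {a b} → before a b ≡ true → adj G a b ≡ true →
                    (a , b) ∈ edgeVec G
∈-edgeVec-ordered G {a} a<b ab = ∈-concatAll _ a (∈-map⁺ (a ,_) (∈-indices _ (cong₂ _∧_ a<b ab)))

∈-edgeVec : ∀ {n} (G : Graph n) {a b} → adj G a b ≡ true → (a , b) ∈ edgeVec G ⊎ (b , a) ∈ edgeVec G
∈-edgeVec G {a} {b} ab with <-cmp (toℕ a) (toℕ b)
... | tri< a<b _ _ = inj₁ (∈-edgeVec-ordered G (before-true a<b) ab)
... | tri> _ _ b<a = inj₂ (∈-edgeVec-ordered G (before-true b<a) (trans (adj-sym G b a) ab))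
... | tri≈ _ a≡b _ =
  ⊥-elim (not-¬ ab (trans (cong (adj G a) (sym (toℕ-injective a≡b))) (adj-irrefl G a)))

edgeEnumeration : ∀ {n m} (G : Graph n) → edgeCount G ≡ m →
                  Σ (Vec (Fin n × Fin n) m) λ R → ∀ {a b} → adj G a b ≡ true → (a , b) ∈ R ⊎ (b , a) ∈ R
edgeEnumeration G refl = edgeVec G , ∈-edgeVec G

-- Walks, connected edge sets and connected subgraphs

EdgeSet : ℕ → Set
EdgeSet n = Fin n → Fin n → Bool

Walkᵇ : ∀ {n} → EdgeSet n → Fin n → Fin n → Set
Walkᵇ E = Walk (λ a b → E a b ≡ true)

_◅◅_ : ∀ {n} {A : Fin n → Fin n → Set} {a b c} → Walk A a b → Walk A b c → Walk A a c
here ◅◅ w′ = w′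
step r w ◅◅ w′ = step r (w ◅◅ w′)

reverse : ∀ {n} {E : EdgeSet n} → (∀ i j → E i j ≡ E j i) → ∀ {a b} → Walkᵇ E a b → Walkᵇ E b a
reverse E-sym here = here
reverse E-sym (step {u = a} {v = z} r w) = reverse E-sym w ◅◅ step (trans (E-sym z a) r) here

mapWalk : ∀ {n} {A B : Fin n → Fin n → Set} → (∀ {a b} → A a b → B a b) →
          ∀ {a b} → Walk A a b → Walk B a b
mapWalk f here = here
mapWalk f (step r w) = step (f r) (mapWalk f w)

firstStep : ∀ {n} {A : Fin n → Fin n → Set} {a b} → Walk A a b → a ≢ b → ∃ λ z → A a z
firstStep here a≢b = ⊥-elim (a≢b refl)
firstStep (step {v = z} r _) _ = z , r

Touches : ∀ {n} → EdgeSet n → Fin n → Set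
Touches E w = ∃ λ j → E w j ≡ true

walk⇒touches : ∀ {n} {E : EdgeSet n} {w a b} → Walkᵇ E w a → E a b ≡ true → Touches E w
walk⇒touches here ab = _ , ab
walk⇒touches (step r _) _ = _ , r

restrict : ∀ {m} → EdgeSet (suc m) → Fin (suc m) → EdgeSet m
restrict E v i j = E (punchIn v i) (punchIn v j)

module _ {m} {E : EdgeSet (suc m)} (E-sym : ∀ i j → E i j ≡ E j i)
         {v u : Fin (suc m)} (onlyNeighbour : ∀ z → E v z ≡ true → z ≡ u) where

  mutual
    shortcutLeaf : ∀ {s t} → Walkᵇ E s t → ∀ {s′ t′} → punchIn v s′ ≡ s → punchIn v t′ ≡ t →
                   Walkᵇ (restrict E v) s′ t′
    shortcutLeaf here ps pt = subst (Walkᵇ _ _) (punchIn-injective v _ _ (trans ps (sym pt))) here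
    shortcutLeaf (step {u = s} {v = z} r w) ps pt with v ≟ z
    ... | no v≢z = step (subst₂ (λ a b → E a b ≡ true) (sym ps) (sym (punchIn-punchOut v≢z)) r)
                        (shortcutLeaf w (punchIn-punchOut v≢z) pt)
    ... | yes refl = shortcutFromLeaf w (trans ps (onlyNeighbour s (trans (E-sym v s) r))) pt

    shortcutFromLeaf : ∀ {t} → Walkᵇ E v t → ∀ {s′ t′} → punchIn v s′ ≡ u → punchIn v t′ ≡ t →
                       Walkᵇ (restrict E v) s′ t′
    shortcutFromLeaf here {t′ = t′} _ pt = ⊥-elim (punchInᵢ≢i v t′ pt)
    shortcutFromLeaf (step {v = z} r w) pu pt = shortcutLeaf w (trans pu (sym (onlyNeighbour z r))) pt

_≐_ : ∀ {n} → EdgeSet n → EdgeSet n → Set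
E ≐ F = ∀ i j → E i j ≡ F i j

Edgeless : ∀ {n} → EdgeSet n → Set
Edgeless E = ∀ i j → E i j ≡ false

HasEdge : ∀ {n} → EdgeSet n → Set
HasEdge E = ∃₂ λ a b → E a b ≡ true

hasEdge? : ∀ {n} (E : EdgeSet n) → Dec (HasEdge E)
hasEdge? E = any? λ a → any? λ b → E a b Bool.≟ true

¬HasEdge⇒Edgeless : ∀ {n} {E : EdgeSet n} → ¬ HasEdge E → Edgeless E
¬HasEdge⇒Edgeless ¬e i j = ¬-not λ e → ¬e (i , j , e)

record IsConnEdgeSet {n} (G : Graph n) (E : EdgeSet n) : Set where
  field
    symmetric : ∀ i j → E i j ≡ E j i
    ⊆-adj     : ∀ i j → E i j ≡ true → adj G i j ≡ true
    linked    : ∀ {a b c d} → E a b ≡ true → E c d ≡ true → Walkᵇ E a c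

ConnEdgeSet : ∀ {n} → Graph n → Set
ConnEdgeSet {n} G = Σ (EdgeSet n) (IsConnEdgeSet G)

noEdges : ∀ {n} {G : Graph n} → ConnEdgeSet G
noEdges = (λ _ _ → false) , record { symmetric = λ _ _ → refl ; ⊆-adj = λ _ _ () ; linked = λ () }

incident : ∀ {n} → EdgeSet n → Fin n → Bool
incident E i = ⌊ any? (λ j → E i j Bool.≟ true) ⌋

incident-intro : ∀ {n} (E : EdgeSet n) {i j} → E i j ≡ true → incident E i ≡ true
incident-intro E {j = j} e = Equivalence.to T-≡ (fromWitness (j , e))

incident-elim : ∀ {n} (E : EdgeSet n) {i} → incident E i ≡ true → ∃ λ j → E i j ≡ true
incident-elim E Vi = toWitness (Equivalence.from T-≡ Vi)

lookup-ext : ∀ {A : Set} {n} {v w : Vec A n} → (∀ i → lookup v i ≡ lookup w i) → v ≡ w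
lookup-ext {v = v} {w} eq =
  trans (sym (Vec.tabulate∘lookup v)) (trans (Vec.tabulate-cong eq) (Vec.tabulate∘lookup w))

tables : ∀ {n} → (Fin n → Bool) → EdgeSet n → SubData n
tables V E = tabulate V , tabulate (tabulate ∘ E)

lookup-tablesᵛ : ∀ {n} V (E : EdgeSet n) i → lookup (proj₁ (tables V E)) i ≡ V i
lookup-tablesᵛ V E = Vec.lookup∘tabulate V

lookup-tablesᵉ : ∀ {n} V (E : EdgeSet n) i j → lookup (lookup (proj₂ (tables V E)) i) j ≡ E i j
lookup-tablesᵉ V E i j =
  trans (cong (λ r → lookup r j) (Vec.lookup∘tabulate (tabulate ∘ E) i)) (Vec.lookup∘tabulate (E i) j)

module _ {n} {G : Graph n} where

  vertexAt : ConnSub G → Fin n → Bool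
  vertexAt x = IsConnSub.V' (proj₂ x)

  edgeAt : ConnSub G → EdgeSet n
  edgeAt x = IsConnSub.E' (proj₂ x)

  base : ConnSub G → Fin n
  base x = proj₁ (IsConnSub.nonempty (proj₂ x))

  base-vertex : ∀ x → vertexAt x (base x) ≡ true
  base-vertex x = proj₂ (IsConnSub.nonempty (proj₂ x))

  fromTables : (V : Fin n → Bool) (E : EdgeSet n) →
               (∃ λ i → V i ≡ true) → IsConnEdgeSet G E →
               (∀ i j → E i j ≡ true → V i ≡ true) →
               (∀ u w → V u ≡ true → V w ≡ true → Walkᵇ E u w) → ConnSub G
  fromTables V E (i , Vi) isConn ends conn = tables V E , record
    { nonempty  = i , trans (lookupV i) Vi
    ; E'-sym    = λ i j → trans (lookupE i j) (trans (symmetric i j) (sym (lookupE j i)))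
    ; E'⊆E      = λ i j e → ⊆-adj i j (trans (sym (lookupE i j)) e)
    ; E'-ends   = λ i j e → let e′ = trans (sym (lookupE i j)) e in
                    trans (lookupV i) (ends i j e′) ,
                    trans (lookupV j) (ends j i (trans (symmetric j i) e′))
    ; connected = λ u w Vu Vw → mapWalk (λ {a} {b} → trans (lookupE a b))
                    (conn u w (trans (sym (lookupV u)) Vu) (trans (sym (lookupV w)) Vw))
    }
    where
    open IsConnEdgeSet isConn
    lookupV : ∀ i → lookup (proj₁ (tables V E)) i ≡ V i
    lookupV = lookup-tablesᵛ V E
    lookupE : ∀ i j → lookup (lookup (proj₂ (tables V E)) i) j ≡ E i j
    lookupE = lookup-tablesᵉ V E

  edgesOf : ConnSub G → ConnEdgeSet G
  edgesOf (_ , x) = E' , record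
    { symmetric = E'-sym
    ; ⊆-adj     = E'⊆E
    ; linked    = λ ab cd → connected _ _ (proj₁ (E'-ends _ _ ab)) (proj₁ (E'-ends _ _ cd))
    }
    where open IsConnSub x

  edgeSubgraph : (E : ConnEdgeSet G) → HasEdge (proj₁ E) → ConnSub G
  edgeSubgraph (E , isConn) (a , b , ab) =
    fromTables (incident E) E (a , incident-intro E ab) isConn (λ _ _ → incident-intro E)
      λ _ _ Vu Vw → linked (proj₂ (incident-elim E Vu)) (proj₂ (incident-elim E Vw))
    where open IsConnEdgeSet isConn

  edgeAt-edgeSubgraph : ∀ E e → edgeAt (edgeSubgraph E e) ≐ proj₁ E
  edgeAt-edgeSubgraph (E , _) (a , b , ab) = lookup-tablesᵉ (incident E) E

  vertexSubgraph : Fin n → ConnSub G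
  vertexSubgraph w =
    fromTables (λ i → ⌊ i ≟ w ⌋) (λ _ _ → false) (w , isSelf refl) (proj₂ noEdges) (λ _ _ ())
      λ u v Vu Vw → subst (Walkᵇ _ u) (trans (fromSelf Vu) (sym (fromSelf Vw))) here
    where
    isSelf : ∀ {i} → i ≡ w → ⌊ i ≟ w ⌋ ≡ true
    isSelf i≡w = Equivalence.to T-≡ (fromWitness i≡w)
    fromSelf : ∀ {i} → ⌊ i ≟ w ⌋ ≡ true → i ≡ w
    fromSelf e = toWitness (Equivalence.from T-≡ e)

  vertexAt-cong : ∀ x y → proj₁ x ≡ proj₁ y → ∀ i → vertexAt x i ≡ vertexAt y i
  vertexAt-cong _ _ eq i = cong (λ d → lookup (proj₁ d) i) eq

  edgeAt-cong : ∀ x y → proj₁ x ≡ proj₁ y → edgeAt x ≐ edgeAt y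
  edgeAt-cong _ _ eq i j = cong (λ d → lookup (lookup (proj₂ d) i) j) eq

  subgraph-≡ : ∀ x y → (∀ i → vertexAt x i ≡ vertexAt y i) → edgeAt x ≐ edgeAt y → proj₁ x ≡ proj₁ y
  subgraph-≡ x y sameV sameE = cong₂ _,_ (lookup-ext sameV) (lookup-ext λ i → lookup-ext (sameE i))

  vertex⇒incident : ∀ x → HasEdge (edgeAt x) → ∀ {i} → vertexAt x i ≡ true → Touches (edgeAt x) i
  vertex⇒incident (_ , x) (a , b , ab) Vi = walk⇒touches (connected _ a Vi (proj₁ (E'-ends a b ab))) ab
    where open IsConnSub x

  sameEdges⇒≡ : ∀ x y → HasEdge (edgeAt x) → edgeAt x ≐ edgeAt y → proj₁ x ≡ proj₁ y
  sameEdges⇒≡ x y (a , b , ab) sameE = subgraph-≡ x y sameV sameE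
    where
    sameV : ∀ i → vertexAt x i ≡ vertexAt y i
    sameV i = ⇔→≡ {z = true} (mk⇔
      (λ Vx → let j , e = vertex⇒incident x (a , b , ab) Vx in
              proj₁ (IsConnSub.E'-ends (proj₂ y) i j (trans (sym (sameE i j)) e)))
      (λ Vy → let j , e = vertex⇒incident y (a , b , trans (sym (sameE a b)) ab) Vy in
              proj₁ (IsConnSub.E'-ends (proj₂ x) i j (trans (sameE i j) e))))

  edgeless⇒unique-vertex : ∀ x → Edgeless (edgeAt x) →
                           ∀ {i j} → vertexAt x i ≡ true → vertexAt x j ≡ true → i ≡ j
  edgeless⇒unique-vertex (_ , x) none Vi Vj with IsConnSub.connected x _ _ Vi Vj
  ... | here = refl
  ... | step e _ = ⊥-elim (not-¬ e (none _ _))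

  sameVertex⇒≡ : ∀ x y → Edgeless (edgeAt x) → Edgeless (edgeAt y) → ∀ {w} →
                 vertexAt x w ≡ true → vertexAt y w ≡ true → proj₁ x ≡ proj₁ y
  sameVertex⇒≡ x y noneˣ noneʸ Vxw Vyw = subgraph-≡ x y sameV λ i j → trans (noneˣ i j) (sym (noneʸ i j))
    where
    sameV : ∀ i → vertexAt x i ≡ vertexAt y i
    sameV i = ⇔→≡ {z = true} (mk⇔
      (λ Vxi → subst (λ k → vertexAt y k ≡ true) (edgeless⇒unique-vertex x noneˣ Vxw Vxi) Vyw)
      (λ Vyi → subst (λ k → vertexAt x k ≡ true) (edgeless⇒unique-vertex y noneʸ Vyw Vyi) Vxw))

  vertexSubgraph-self : ∀ w → vertexAt (vertexSubgraph w) w ≡ true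
  vertexSubgraph-self w = base-vertex (vertexSubgraph w)

  vertexSubgraph-edgeless : ∀ w → Edgeless (edgeAt (vertexSubgraph w))
  vertexSubgraph-edgeless w = lookup-tablesᵉ (λ i → ⌊ i ≟ w ⌋) (λ _ _ → false)

  vertexSubgraph-injective : ∀ w w′ → proj₁ (vertexSubgraph w) ≡ proj₁ (vertexSubgraph w′) → w ≡ w′
  vertexSubgraph-injective w w′ eq =
    edgeless⇒unique-vertex (vertexSubgraph w′) (vertexSubgraph-edgeless w′)
      (trans (sym (vertexAt-cong (vertexSubgraph w) (vertexSubgraph w′) eq w)) (vertexSubgraph-self w))
      (vertexSubgraph-self w′)

  edgeSubgraph≢vertexSubgraph : ∀ E e w → proj₁ (edgeSubgraph E e) ≢ proj₁ (vertexSubgraph w)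
  edgeSubgraph≢vertexSubgraph E e@(a , b , ab) w eq =
    not-¬ (trans (edgeAt-edgeSubgraph E e a b) ab)
          (trans (edgeAt-cong (edgeSubgraph E e) (vertexSubgraph w) eq a b)
                 (vertexSubgraph-edgeless w a b))

singleEdgeSet : ∀ {n} → Fin n → Fin n → EdgeSet n
singleEdgeSet a b i j = ⌊ i ≟ a ⌋ ∧ ⌊ j ≟ b ⌋ ∨ ⌊ i ≟ b ⌋ ∧ ⌊ j ≟ a ⌋

module _ {n} (a b : Fin n) where

  singleEdgeSet-sound : ∀ i j → singleEdgeSet a b i j ≡ true → (i ≡ a × j ≡ b) ⊎ (i ≡ b × j ≡ a)
  singleEdgeSet-sound i j e =
    Sum.map witnesses witnesses (Equivalence.to (T-∨ {⌊ i ≟ a ⌋ ∧ ⌊ j ≟ b ⌋}) (Equivalence.from T-≡ e))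
    where
    witnesses : ∀ {i j k l : Fin n} → T (⌊ i ≟ k ⌋ ∧ ⌊ j ≟ l ⌋) → i ≡ k × j ≡ l
    witnesses {i} {j} {k} {l} t = let p , q = Equivalence.to (T-∧ {⌊ i ≟ k ⌋}) t in
                                  toWitness {a? = i ≟ k} p , toWitness {a? = j ≟ l} q

  singleEdgeSet-sym : ∀ i j → singleEdgeSet a b i j ≡ singleEdgeSet a b j i
  singleEdgeSet-sym i j = trans (∨-comm (⌊ i ≟ a ⌋ ∧ ⌊ j ≟ b ⌋) _)
                                (cong₂ _∨_ (∧-comm ⌊ i ≟ b ⌋ ⌊ j ≟ a ⌋) (∧-comm ⌊ i ≟ a ⌋ ⌊ j ≟ b ⌋))

  singleEdgeSet-ab : singleEdgeSet a b a b ≡ true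
  singleEdgeSet-ab = Equivalence.to T-≡ (Equivalence.from (T-∨ {x = ⌊ a ≟ a ⌋ ∧ ⌊ b ≟ b ⌋})
    (inj₁ (Equivalence.from T-∧ (fromWitness {a? = a ≟ a} refl , fromWitness {a? = b ≟ b} refl))))

singleEdge : ∀ {n} {G : Graph n} {a b} → adj G a b ≡ true → ConnEdgeSet G
singleEdge {G = G} {a} {b} ab = singleEdgeSet a b , record
  { symmetric = singleEdgeSet-sym a b
  ; ⊆-adj     = λ i j e → [ (λ where (refl , refl) → ab)
                            , (λ where (refl , refl) → trans (adj-sym G b a) ab) ]′ (singleEdgeSet-sound a b i j e)
  ; linked    = λ {p} {q} {r} {s} pq rs →
                  toA (singleEdgeSet-sound a b p q pq) ◅◅
                  reverse (singleEdgeSet-sym a b) (toA (singleEdgeSet-sound a b r s rs))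
  }
  where
  toA : ∀ {p q} → (p ≡ a × q ≡ b) ⊎ (p ≡ b × q ≡ a) → Walkᵇ (singleEdgeSet a b) p a
  toA (inj₁ (refl , _)) = here
  toA (inj₂ (refl , _)) = step (trans (singleEdgeSet-sym a b b a) (singleEdgeSet-ab a b)) here

-- Edge sets of the pineapple

-- Bit order: the triangle edges 01, 02, 12, then the pendant edges 0(3+i).
Code : ℕ → Set
Code k = Vec Bool (3 + k)

emptyCode : ∀ k → Code k
emptyCode k = replicate (3 + k) false

edge₁₂Code : ∀ k → Code k
edge₁₂Code k = false ∷ false ∷ true ∷ replicate k false

arc : ∀ {k} → Code k → Fin (3 + k) → Fin (3 + k) → Bool
arc (x ∷ _ ∷ _ ∷ _) 0F 1F = x
arc (_ ∷ y ∷ _ ∷ _) 0F 2F = y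
arc (_ ∷ _ ∷ _ ∷ s) 0F (suc (suc (suc j))) = lookup s j
arc (_ ∷ _ ∷ _ ∷ _) 0F 0F = false
arc (_ ∷ _ ∷ z ∷ _) 1F 2F = z
arc (_ ∷ _ ∷ _ ∷ _) 1F 0F = false
arc (_ ∷ _ ∷ _ ∷ _) 1F 1F = false
arc (_ ∷ _ ∷ _ ∷ _) 1F (suc (suc (suc j))) = false
arc (_ ∷ _ ∷ _ ∷ _) (suc (suc _)) _ = false

codeEdges : ∀ {k} → Code k → EdgeSet (3 + k)
codeEdges c i j = arc c i j ∨ arc c j i

-- The only disconnected nonempty edge sets of the pineapple are 12 plus some pendant edges.
data ConnCode {k} : Code k → Set where
  via₀₁  : ∀ {x y s} → ConnCode (true ∷ x ∷ y ∷ s)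
  via₀₂  : ∀ {x y s} → ConnCode (x ∷ true ∷ y ∷ s)
  edge₁₂ : ConnCode (edge₁₂Code k)
  star   : ∀ {s} → ConnCode (false ∷ false ∷ false ∷ s)

arc⊆pineapple : ∀ {k} (c : Code k) i j → arc c i j ≡ true → pineAdj i j ≡ true
arc⊆pineapple (_ ∷ _ ∷ _ ∷ _) 0F 1F _ = refl
arc⊆pineapple (_ ∷ _ ∷ _ ∷ _) 0F 2F _ = refl
arc⊆pineapple (_ ∷ _ ∷ _ ∷ _) 1F 2F _ = refl
arc⊆pineapple (_ ∷ _ ∷ _ ∷ _) 0F (suc (suc (suc i))) _ = refl

codeEdges⊆pineapple : ∀ {k} (c : Code k) i j → codeEdges c i j ≡ true → pineAdj i j ≡ true
codeEdges⊆pineapple c i j e with arc c i j in a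
... | true = arc⊆pineapple c i j a
... | false = trans (pineAdj-sym i j) (arc⊆pineapple c j i e)

pendant-edge : ∀ {k} (c : Code k) i b → codeEdges c (suc (suc (suc i))) b ≡ true →
               codeEdges c (suc (suc (suc i))) 0F ≡ true
pendant-edge (_ ∷ _ ∷ _ ∷ _) i 0F e = e
pendant-edge (_ ∷ _ ∷ _ ∷ _) i 1F ()
pendant-edge (_ ∷ _ ∷ _ ∷ _) i 2F ()
pendant-edge (_ ∷ _ ∷ _ ∷ _) i (suc (suc (suc _))) ()

hub : ∀ {k} {c : Code k} → ConnCode c → Fin (3 + k)
hub edge₁₂ = 1F
hub _ = 0F

toHub : ∀ {k} {c : Code k} (cc : ConnCode c) {a b} → codeEdges c a b ≡ true →
        Walkᵇ (codeEdges c) a (hub cc)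
toHub via₀₁ {0F} e = here
toHub via₀₁ {1F} e = step refl here
toHub (via₀₁ {true}) {2F} e = step refl here
toHub (via₀₁ {false}) {2F} {1F} e = step {v = 1F} e (step refl here)
toHub {c = c} via₀₁ {suc (suc (suc i))} {b} e = step (pendant-edge c i b e) here
toHub via₀₂ {0F} e = here
toHub via₀₂ {2F} e = step refl here
toHub (via₀₂ {true}) {1F} e = step refl here
toHub (via₀₂ {false}) {1F} {2F} e = step {v = 2F} e (step refl here)
toHub {c = c} via₀₂ {suc (suc (suc i))} {b} e = step (pendant-edge c i b e) here
toHub edge₁₂ {1F} e = here
toHub edge₁₂ {2F} e = step refl here
toHub edge₁₂ {0F} {suc (suc (suc j))} e =
  ⊥-elim (not-¬ e (trans (∨-identityʳ _) (Vec.lookup-replicate j false)))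
toHub {c = c} edge₁₂ {suc (suc (suc i))} {b} e =
  ⊥-elim (not-¬ (pendant-edge c i b e) (Vec.lookup-replicate i false))
toHub star {0F} e = here
toHub star {1F} {suc (suc (suc _))} ()
toHub star {2F} {suc (suc (suc _))} ()
toHub {c = c} star {suc (suc (suc i))} {b} e = step (pendant-edge c i b e) here

decode : ∀ {k} {c : Code k} → ConnCode c → ConnEdgeSet (pineapple (3 + k))
decode {c = c} cc = codeEdges c , record
  { symmetric = codeEdges-sym
  ; ⊆-adj     = codeEdges⊆pineapple c
  ; linked    = λ ab cd → toHub cc ab ◅◅ reverse codeEdges-sym (toHub cc cd)
  }
  where
  codeEdges-sym : ∀ i j → codeEdges c i j ≡ codeEdges c j i
  codeEdges-sym i j = ∨-comm (arc c i j) (arc c j i)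

codeEdges-injective : ∀ {k} (c c′ : Code k) → codeEdges c ≐ codeEdges c′ → c ≡ c′
codeEdges-injective (x ∷ y ∷ z ∷ s) (x′ ∷ y′ ∷ z′ ∷ s′) same =
  cong₂ _∷_ (strip (same 0F 1F)) (cong₂ _∷_ (strip (same 0F 2F)) (cong₂ _∷_ (strip (same 1F 2F))
    (lookup-ext λ i → strip (same 0F (suc (suc (suc i)))))))
  where
  strip : ∀ {a b} → a ∨ false ≡ b ∨ false → a ≡ b
  strip {a} {b} eq = trans (sym (∨-identityʳ a)) (trans eq (∨-identityʳ b))

nonempty-code⇒edge : ∀ {k} (c : Code k) → c ≢ emptyCode k → HasEdge (codeEdges c)
nonempty-code⇒edge (true ∷ _ ∷ _ ∷ _) _ = 0F , 1F , refl
nonempty-code⇒edge (false ∷ true ∷ _ ∷ _) _ = 0F , 2F , refl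
nonempty-code⇒edge (false ∷ false ∷ true ∷ _) _ = 1F , 2F , refl
nonempty-code⇒edge (false ∷ false ∷ false ∷ s) c≢0 =
  let i , sᵢ = someTrue s (c≢0 ∘ cong (λ s → false ∷ false ∷ false ∷ s)) in
  0F , suc (suc (suc i)) , trans (∨-identityʳ _) sᵢ
  where
  someTrue : ∀ {k} (s : Vec Bool k) → s ≢ replicate k false → ∃ λ i → lookup s i ≡ true
  someTrue [] s≢0 = ⊥-elim (s≢0 refl)
  someTrue (true ∷ s) _ = zero , refl
  someTrue (false ∷ s) s≢0 = let i , sᵢ = someTrue s (s≢0 ∘ cong (false ∷_)) in suc i , sᵢ

insertPendant : ∀ {k} → Bool → Code k → Code (suc k)
insertPendant b (x ∷ y ∷ z ∷ s) = x ∷ y ∷ z ∷ b ∷ s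

insertPendant-injective : ∀ {k b b′} (c c′ : Code k) → insertPendant b c ≡ insertPendant b′ c′ →
                          b ≡ b′ × c ≡ c′
insertPendant-injective (_ ∷ _ ∷ _ ∷ _) (_ ∷ _ ∷ _ ∷ _) refl = refl , refl

ConnCode-insert-false : ∀ {k} {c : Code k} → ConnCode c → ConnCode (insertPendant false c)
ConnCode-insert-false via₀₁ = via₀₁
ConnCode-insert-false via₀₂ = via₀₂
ConnCode-insert-false edge₁₂ = edge₁₂
ConnCode-insert-false star = star

ConnCode-insert-true : ∀ {k} {c : Code k} → ConnCode c → c ≢ edge₁₂Code k →
                       ConnCode (insertPendant true c)
ConnCode-insert-true via₀₁ _ = via₀₁
ConnCode-insert-true via₀₂ _ = via₀₂
ConnCode-insert-true edge₁₂ c≢e₁₂ = ⊥-elim (c≢e₁₂ refl)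
ConnCode-insert-true star _ = star

-- Encodings of connected edge sets: the leaf step and the cycle

-- Empty edge sets are included, so that restriction to G − v is total.
record PineappleEncoding {k} (G : Graph (3 + k)) : Set where
  field
    encode           : ConnEdgeSet G → Code k
    encode-conn      : ∀ E → ConnCode (encode E)
    encode-edgeless  : ∀ E → Edgeless (proj₁ E) → encode E ≡ emptyCode k
    encode-injective : ∀ E F → encode E ≡ encode F → proj₁ E ≐ proj₁ F

record EdgeAvoiding {n} (G : Graph n) (w : Fin n) : Set where
  constructor edgeAvoiding
  field
    a b : Fin n
    a~b : adj G a b ≡ true
    a≢w : a ≢ w
    b≢w : b ≢ w

record Leaf {n} (G : Graph n) (v u : Fin n) : Set where
  field
    adjacent : adj G v u ≡ true
    unique   : ∀ z → adj G v z ≡ true → z ≡ u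

EdgeAvoiding-deleteVertex : ∀ {n} (G : Graph (suc (suc n))) v →
  (∀ w → EdgeAvoiding (deleteVertex G v) w) → ∀ w → EdgeAvoiding G w
EdgeAvoiding-deleteVertex G v avoiding w with v ≟ w
... | yes refl = let edgeAvoiding a b a~b _ _ = avoiding zero in
                 edgeAvoiding (punchIn v a) (punchIn v b) a~b (punchInᵢ≢i v a) (punchInᵢ≢i v b)
... | no v≢w = let edgeAvoiding a b a~b a≢w′ b≢w′ = avoiding (punchOut v≢w) in
               edgeAvoiding (punchIn v a) (punchIn v b) a~b (lift a≢w′) (lift b≢w′)
  where
  lift : ∀ {a} → a ≢ punchOut v≢w → punchIn v a ≢ w
  lift a≢w′ eq = a≢w′ (punchIn-injective v _ _ (trans eq (sym (punchIn-punchOut v≢w))))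

module LeafStep {k} {G : Graph (4 + k)} {v u} (leaf : Leaf G v u)
                (avoiding : ∀ w → EdgeAvoiding (deleteVertex G v) w)
                (enc : PineappleEncoding (deleteVertex G v)) where

  open Leaf leaf
  open PineappleEncoding enc
  G′ : Graph (3 + k)
  G′ = deleteVertex G v

  _≟ᶜ_ : (c c′ : Code k) → Dec (c ≡ c′)
  _≟ᶜ_ = Vec.≡-dec Bool._≟_

  v≢u : v ≢ u
  v≢u refl = not-¬ adjacent (adj-irrefl G v)

  u′ : Fin (3 + k)
  u′ = punchOut v≢u

  leafRow : ∀ (E : ConnEdgeSet G) {j} → proj₁ E v j ≡ true → j ≡ u
  leafRow (_ , isConn) e = unique _ (IsConnEdgeSet.⊆-adj isConn v _ e)

  shortcut : ∀ (E : ConnEdgeSet G) {s t} → Walkᵇ (proj₁ E) s t → ∀ {s′ t′} →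
             punchIn v s′ ≡ s → punchIn v t′ ≡ t → Walkᵇ (restrict (proj₁ E) v) s′ t′
  shortcut E@(_ , isConn) = shortcutLeaf (IsConnEdgeSet.symmetric isConn) (λ _ → leafRow E)

  restrictSet : ConnEdgeSet G → ConnEdgeSet G′
  restrictSet E@(E′ , isConn) = restrict E′ v , record
    { symmetric = λ i j → symmetric (punchIn v i) (punchIn v j)
    ; ⊆-adj     = λ i j → ⊆-adj (punchIn v i) (punchIn v j)
    ; linked    = λ ab cd → shortcut E (linked ab cd) refl refl
    }
    where open IsConnEdgeSet isConn

  sameLeafRow : ∀ E F → proj₁ E v u ≡ proj₁ F v u → ∀ j → proj₁ E v j ≡ proj₁ F v j
  sameLeafRow E F same j = ⇔→≡ {z = true} (mk⇔ (transfer E F same) (transfer F E (sym same)))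
    where
    transfer : ∀ E F → proj₁ E v u ≡ proj₁ F v u → proj₁ E v j ≡ true → proj₁ F v j ≡ true
    transfer E F same e with leafRow E e
    ... | refl = trans (sym same) e

  ≐-from-restriction : ∀ E F → proj₁ (restrictSet E) ≐ proj₁ (restrictSet F) →
                       proj₁ E v u ≡ proj₁ F v u → proj₁ E ≐ proj₁ F
  ≐-from-restriction E@(E′ , isConnᴱ) F@(F′ , isConnᶠ) sameR sameVU i j with v ≟ i | v ≟ j
  ... | yes refl | _ = sameLeafRow E F sameVU j
  ... | no _ | yes refl = trans (IsConnEdgeSet.symmetric isConnᴱ i v)
                                (trans (sameLeafRow E F sameVU i) (IsConnEdgeSet.symmetric isConnᶠ v i))
  ... | no v≢i | no v≢j =
    subst₂ (λ a b → E′ a b ≡ F′ a b) (punchIn-punchOut v≢i) (punchIn-punchOut v≢j) (sameR _ _)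

  -- A connected E′ stays connected when the leaf edge u′v is added iff it is attachable.
  AttachableAtU′ : EdgeSet (3 + k) → Set
  AttachableAtU′ E′ = Edgeless E′ ⊎ Touches E′ u′

  restriction-attachable : ∀ E → proj₁ E v u ≡ true → AttachableAtU′ (proj₁ (restrictSet E))
  restriction-attachable E vu with hasEdge? (proj₁ (restrictSet E))
  ... | no none = inj₁ (¬HasEdge⇒Edgeless none)
  ... | yes (a , b , ab) = inj₂ (walk⇒touches u′→a ab)
    where
    open IsConnEdgeSet (proj₂ E)
    u′→a : Walkᵇ (proj₁ (restrictSet E)) u′ a
    u′→a = shortcut E (linked (trans (symmetric u v) vu) ab) (punchIn-punchOut v≢u) refl

  open EdgeAvoiding (avoiding u′) renaming (a to a₀; b to b₀; a~b to a₀~b₀; a≢w to a₀≢u′; b≢w to b₀≢u′)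

  S₀ : ConnEdgeSet G′
  S₀ = singleEdge a₀~b₀

  S₀-not-attachable : ∀ {E′} → AttachableAtU′ E′ → ¬ E′ ≐ proj₁ S₀
  S₀-not-attachable (inj₁ none) same =
    not-¬ (singleEdgeSet-ab a₀ b₀) (trans (sym (same a₀ b₀)) (none a₀ b₀))
  S₀-not-attachable (inj₂ (j , e)) same with singleEdgeSet-sound a₀ b₀ u′ j (trans (sym (same u′ j)) e)
  ... | inj₁ (u′≡a₀ , _) = a₀≢u′ (sym u′≡a₀)
  ... | inj₂ (u′≡b₀ , _) = b₀≢u′ (sym u′≡b₀)

  -- The code of {12} cannot take a pendant bit, so it is traded for the code of S₀, which no
  -- attachable edge set has.
  encodeAttachable : ConnEdgeSet G′ → Code k
  encodeAttachable E′ with encode E′ ≟ᶜ edge₁₂Code k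
  ... | yes _ = encode S₀
  ... | no _ = encode E′

  encodeAttachable-conn : ∀ E′ → AttachableAtU′ (proj₁ E′) →
                          ConnCode (encodeAttachable E′) × encodeAttachable E′ ≢ edge₁₂Code k
  encodeAttachable-conn E′ attachable with encode E′ ≟ᶜ edge₁₂Code k
  ... | yes E′↦e₁₂ = encode-conn S₀ , λ S₀↦e₁₂ →
          S₀-not-attachable attachable (encode-injective E′ S₀ (trans E′↦e₁₂ (sym S₀↦e₁₂)))
  ... | no E′↦̸e₁₂ = encode-conn E′ , E′↦̸e₁₂

  encodeAttachable-injective : ∀ E′ F′ → AttachableAtU′ (proj₁ E′) → AttachableAtU′ (proj₁ F′) →
                               encodeAttachable E′ ≡ encodeAttachable F′ → proj₁ E′ ≐ proj₁ F′
  encodeAttachable-injective E′ F′ attachableE attachableF eq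
    with encode E′ ≟ᶜ edge₁₂Code k | encode F′ ≟ᶜ edge₁₂Code k
  ... | yes E′↦e₁₂ | yes F′↦e₁₂ = encode-injective E′ F′ (trans E′↦e₁₂ (sym F′↦e₁₂))
  ... | no _ | no _ = encode-injective E′ F′ eq
  ... | yes _ | no _ = ⊥-elim (S₀-not-attachable attachableF λ i j → sym (encode-injective S₀ F′ eq i j))
  ... | no _ | yes _ = ⊥-elim (S₀-not-attachable attachableE (encode-injective E′ S₀ eq))

  encodeG : ConnEdgeSet G → Code (suc k)
  encodeG E = if proj₁ E v u then insertPendant true (encodeAttachable (restrictSet E))
                             else insertPendant false (encode (restrictSet E))

  encoding : PineappleEncoding G
  encoding = record
    { encode           = encodeG
    ; encode-conn      = conn
    ; encode-edgeless  = edgeless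
    ; encode-injective = injective
    }
    where
    conn : ∀ E → ConnCode (encodeG E)
    conn E with proj₁ E v u in vu
    ... | true = let c , c≢e₁₂ = encodeAttachable-conn (restrictSet E) (restriction-attachable E vu) in
                 ConnCode-insert-true c c≢e₁₂
    ... | false = ConnCode-insert-false (encode-conn (restrictSet E))

    edgeless : ∀ E → Edgeless (proj₁ E) → encodeG E ≡ emptyCode (suc k)
    edgeless E none with proj₁ E v u in vu
    ... | true = ⊥-elim (not-¬ vu (none v u))
    ... | false = cong (insertPendant false) (encode-edgeless (restrictSet E) λ _ _ → none _ _)

    injective : ∀ E F → encodeG E ≡ encodeG F → proj₁ E ≐ proj₁ F
    injective E F eq with proj₁ E v u in vuᴱ | proj₁ F v u in vuᶠ
    ... | true | true = ≐-from-restriction E F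
          (encodeAttachable-injective (restrictSet E) (restrictSet F)
             (restriction-attachable E vuᴱ) (restriction-attachable F vuᶠ)
             (proj₂ (insertPendant-injective (encodeAttachable (restrictSet E))
                                             (encodeAttachable (restrictSet F)) eq)))
          (trans vuᴱ (sym vuᶠ))
    ... | false | false = ≐-from-restriction E F
          (encode-injective (restrictSet E) (restrictSet F)
             (proj₂ (insertPendant-injective (encode (restrictSet E)) (encode (restrictSet F)) eq)))
          (trans vuᴱ (sym vuᶠ))
    ... | true | false =
          ⊥-elim (not-¬ (proj₁ (insertPendant-injective (encodeAttachable (restrictSet E)) _ eq)) refl)
    ... | false | true =
          ⊥-elim (not-¬ (proj₁ (insertPendant-injective _ (encodeAttachable (restrictSet F)) eq)) refl)

TwoRegular : ∀ {n} → Graph n → Set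
TwoRegular G = ∀ w → deg G w ≡ 2

TwoRegular⇒EdgeAvoiding : ∀ {n} (G : Graph (suc n)) → TwoRegular G → ∀ w → EdgeAvoiding G w
TwoRegular⇒EdgeAvoiding G regular w =
  let a , w~a = count-witness (adj G w) (λ deg≡0 → 1+n≢0 (trans (sym (regular w)) deg≡0))
      b , b≢w , a~b , _ = count≡2⇒other (adj G a) (regular a) (trans (adj-sym G a w) w~a)
  in edgeAvoiding a b a~b (λ a≡w → not-¬ (subst (λ z → adj G w z ≡ true) a≡w w~a) (adj-irrefl G w)) b≢w

map-≡⇒∈-≡ : ∀ {A B : Set} {n} {f g : A → B} {xs : Vec A n} → Vec.map f xs ≡ Vec.map g xs →
            ∀ {x} → x ∈ xs → f x ≡ g x
map-≡⇒∈-≡ eq (here refl) = Vec.∷-injectiveˡ eq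
map-≡⇒∈-≡ eq (there x∈) = map-≡⇒∈-≡ (Vec.∷-injectiveʳ eq) x∈

module CycleStep {k} {G : Graph (3 + k)} (edges : edgeCount G ≡ 3 + k) (regular : TwoRegular G)
                 {y₁ : Fin (2 + k)} {x′ y′ : Fin (3 + k)} (0~y : adj G 0F (suc y₁) ≡ true)
                 (nbrs₀ : ∀ j → adj G 0F j ≡ true → j ≡ suc y₁ ⊎ j ≡ x′)
                 (nbrsʸ : ∀ j → adj G (suc y₁) j ≡ true → j ≡ 0F ⊎ j ≡ y′) where

  y : Fin (3 + k)
  y = suc y₁

  G₁ : Graph (2 + k)
  G₁ = deleteVertex G 0F

  G₂ : Graph (1 + k)
  G₂ = deleteVertex G₁ y₁

  ι : Fin (1 + k) → Fin (3 + k)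
  ι a = suc (punchIn y₁ a)

  edgeCount-G₂ : edgeCount G₂ ≡ k
  edgeCount-G₂ = cong (pred ∘ pred ∘ pred) (begin
    3 + edgeCount G₂                ≡⟨ cong (λ d → 2 + (d + edgeCount G₂)) deg-y₁ ⟨
    2 + (deg G₁ y₁ + edgeCount G₂)  ≡⟨ cong₂ _+_ (regular 0F) (edgeCount-deleteVertex G₁ y₁) ⟨
    deg G 0F + edgeCount G₁         ≡⟨ edgeCount-deleteVertex G 0F ⟨
    edgeCount G                     ≡⟨ edges ⟩
    3 + k                           ∎)
    where
    open ≡-Reasoning
    deg-y₁ : deg G₁ y₁ ≡ 1
    deg-y₁ = cong pred (begin
      suc (deg G₁ y₁)                 ≡⟨ cong (λ b → bit b + deg G₁ y₁) (trans (adj-sym G y 0F) 0~y) ⟨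
      bit (adj G y 0F) + deg G₁ y₁    ≡⟨ count-remove (adj G y) 0F ⟨
      deg G y                         ≡⟨ regular y ⟩
      2                               ∎)

  opaque
    R : Vec (Fin (1 + k) × Fin (1 + k)) k
    R = proj₁ (edgeEnumeration G₂ edgeCount-G₂)

    ∈-R : ∀ {a b} → adj G₂ a b ≡ true → (a , b) ∈ R ⊎ (b , a) ∈ R
    ∈-R = proj₂ (edgeEnumeration G₂ edgeCount-G₂)

  data Listed : Fin (3 + k) → Fin (3 + k) → Set where
    e₀ₓ  : Listed 0F x′
    eᵧᵧ  : Listed y y′
    e₀ᵧ  : Listed 0F y
    rest : ∀ {a b} → adj G₂ a b ≡ true → Listed (ι a) (ι b)

  classify : ∀ i j → adj G i j ≡ true → Listed i j ⊎ Listed j i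
  classify 0F j i~j with nbrs₀ j i~j
  ... | inj₁ refl = inj₁ e₀ᵧ
  ... | inj₂ refl = inj₁ e₀ₓ
  classify (suc i₁) j i~j with y₁ ≟ i₁
  ... | yes refl with nbrsʸ j i~j
  ...   | inj₁ refl = inj₂ e₀ᵧ
  ...   | inj₂ refl = inj₁ eᵧᵧ
  classify (suc i₁) 0F i~j | no y₁≢i₁ with nbrs₀ (suc i₁) (trans (adj-sym G 0F (suc i₁)) i~j)
  ...   | inj₁ i≡y = ⊥-elim (y₁≢i₁ (sym (suc-injective i≡y)))
  ...   | inj₂ refl = inj₂ e₀ₓ
  classify (suc i₁) (suc j₁) i~j | no y₁≢i₁ with y₁ ≟ j₁
  ...   | yes refl with nbrsʸ (suc i₁) (trans (adj-sym G y (suc i₁)) i~j)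
  ...     | inj₂ refl = inj₂ eᵧᵧ
  classify (suc i₁) (suc j₁) i~j | no y₁≢i₁ | no y₁≢j₁ =
    subst₂ (λ s t → Listed (suc s) (suc t) ⊎ Listed (suc t) (suc s))
           (punchIn-punchOut y₁≢i₁) (punchIn-punchOut y₁≢j₁)
           (inj₁ (rest (subst₂ (λ s t → adj G (suc s) (suc t) ≡ true)
                               (sym (punchIn-punchOut y₁≢i₁)) (sym (punchIn-punchOut y₁≢j₁)) i~j)))

  restBits : EdgeSet (3 + k) → Vec Bool k
  restBits E = Vec.map (λ (a , b) → E (ι a) (ι b)) R

  encode : ConnEdgeSet G → Code k
  encode (E , _) = E 0F x′ ∷ E y y′ ∷ E 0F y ∷ restBits E

  restBits-false : ∀ E → (∀ a b → E (ι a) (ι b) ≡ false) → restBits E ≡ replicate k false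
  restBits-false E none = trans (Vec.map-cong (λ (a , b) → none a b) R) (Vec.map-const R false)

  encode-listed : ∀ E F → encode E ≡ encode F → ∀ {i j} → Listed i j → proj₁ E i j ≡ proj₁ F i j
  encode-listed _ _ eq e₀ₓ = Vec.∷-injectiveˡ eq
  encode-listed _ _ eq eᵧᵧ = Vec.∷-injectiveˡ (Vec.∷-injectiveʳ eq)
  encode-listed _ _ eq e₀ᵧ = Vec.∷-injectiveˡ (Vec.∷-injectiveʳ (Vec.∷-injectiveʳ eq))
  encode-listed (E , isConnᴱ) (F , isConnᶠ) eq (rest {a} {b} a~b) =
    [ map-≡⇒∈-≡ sameRest
    , (λ ba∈R → trans (IsConnEdgeSet.symmetric isConnᴱ (ι a) (ι b))
                      (trans (map-≡⇒∈-≡ sameRest ba∈R) (IsConnEdgeSet.symmetric isConnᶠ (ι b) (ι a)))) ]′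
    (∈-R a~b)
    where
    sameRest : restBits E ≡ restBits F
    sameRest = Vec.∷-injectiveʳ (Vec.∷-injectiveʳ (Vec.∷-injectiveʳ eq))

  transfer : ∀ E F → encode E ≡ encode F → ∀ {i j} → proj₁ E i j ≡ true → proj₁ F i j ≡ true
  transfer E@(_ , isConnᴱ) F@(_ , isConnᶠ) eq {i} {j} e
    with classify i j (IsConnEdgeSet.⊆-adj isConnᴱ i j e)
  ... | inj₁ l = trans (sym (encode-listed E F eq l)) e
  ... | inj₂ l = trans (IsConnEdgeSet.symmetric isConnᶠ i j)
                       (trans (sym (encode-listed E F eq l))
                              (trans (IsConnEdgeSet.symmetric isConnᴱ j i) e))

  encode-injective : ∀ E F → encode E ≡ encode F → proj₁ E ≐ proj₁ F
  encode-injective E F eq i j = ⇔→≡ {z = true} (mk⇔ (transfer E F eq) (transfer F E (sym eq)))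

  confined : ∀ (E : ConnEdgeSet G) → proj₁ E 0F x′ ≡ false → proj₁ E y y′ ≡ false →
             ∀ {s t} → Walkᵇ (proj₁ E) s t → s ≡ 0F ⊎ s ≡ y → t ≡ 0F ⊎ t ≡ y
  confined E no₀ₓ noᵧᵧ here s∈ = s∈
  confined E no₀ₓ noᵧᵧ (step {v = z} r w) (inj₁ refl) with nbrs₀ z (IsConnEdgeSet.⊆-adj (proj₂ E) 0F z r)
  ... | inj₁ z≡y = confined E no₀ₓ noᵧᵧ w (inj₂ z≡y)
  ... | inj₂ refl = ⊥-elim (not-¬ r no₀ₓ)
  confined E no₀ₓ noᵧᵧ (step {v = z} r w) (inj₂ refl) with nbrsʸ z (IsConnEdgeSet.⊆-adj (proj₂ E) y z r)
  ... | inj₁ z≡0 = confined E no₀ₓ noᵧᵧ w (inj₁ z≡0)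
  ... | inj₂ refl = ⊥-elim (not-¬ r noᵧᵧ)

  encode-conn : ∀ E → ConnCode (encode E)
  encode-conn E@(E′ , isConn) with E′ 0F x′ in e₀ₓ | E′ y y′ in eᵧᵧ | E′ 0F y in e₀ᵧ
  ... | true  | _     | _     = via₀₁
  ... | false | true  | _     = via₀₂
  ... | false | false | false = star
  ... | false | false | true  =
        subst (λ s → ConnCode (false ∷ false ∷ true ∷ s)) (sym (restBits-false E′ isolated)) edge₁₂
    where
    isolated : ∀ a b → E′ (ι a) (ι b) ≡ false
    isolated a b = ¬-not λ e → [ (λ ()) , (λ ιa≡y → punchInᵢ≢i y₁ a (suc-injective ιa≡y)) ]′
                                 (confined E e₀ₓ eᵧᵧ (IsConnEdgeSet.linked isConn e₀ᵧ e) (inj₁ refl))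

  encoding : PineappleEncoding G
  encoding = record
    { encode           = encode
    ; encode-conn      = encode-conn
    ; encode-edgeless  = λ where
        (E , _) none → cong₂ _∷_ (none 0F x′) (cong₂ _∷_ (none y y′) (cong₂ _∷_ (none 0F y)
                         (restBits-false E λ a b → none (ι a) (ι b))))
    ; encode-injective = encode-injective
    }

cycleEncoding : ∀ {k} (G : Graph (3 + k)) → edgeCount G ≡ 3 + k → TwoRegular G → PineappleEncoding G
cycleEncoding G edges regular
  with count-witness (adj G 0F) (λ deg≡0 → 1+n≢0 (trans (sym (regular 0F)) deg≡0))
... | 0F , 0~0 = ⊥-elim (not-¬ 0~0 (adj-irrefl G 0F))
... | suc y₁ , 0~y =
  let _ , _ , _ , nbrs₀ = count≡2⇒other (adj G 0F) (regular 0F) 0~y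
      _ , _ , _ , nbrsʸ = count≡2⇒other (adj G (suc y₁)) (regular (suc y₁))
                                        (trans (adj-sym G (suc y₁) 0F) 0~y)
  in CycleStep.encoding edges regular 0~y nbrs₀ nbrsʸ

-- Unicyclic graphs

two-vertex-edgeCount≢2 : (H : Graph 2) → edgeCount H ≢ 2
two-vertex-edgeCount≢2 H with adj H 0F 1F
... | true = λ ()
... | false = λ ()

connected⇒deg≢0 : ∀ {n} (G : Graph (suc (suc n))) → Connected G → ∀ w → deg G w ≢ 0
connected⇒deg≢0 G conn w deg≡0 =
  let z , w~z = firstStep (conn w (other w)) (other≢ w) in
  not-¬ w~z (count≡0⇒false (adj G w) deg≡0 z)
  where
  other : ∀ {n} → Fin (suc (suc n)) → Fin (suc (suc n))
  other zero = 1F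
  other (suc _) = 0F
  other≢ : ∀ {n} (w : Fin (suc (suc n))) → w ≢ other w
  other≢ zero ()
  other≢ (suc _) ()

deleteLeaf-edgeCount : ∀ {n m} (G : Graph (suc n)) v → edgeCount G ≡ suc m → deg G v ≡ 1 →
                       edgeCount (deleteVertex G v) ≡ m
deleteLeaf-edgeCount G v edges deg≡1 =
  cong pred (trans (sym (trans (edgeCount-deleteVertex G v) (cong (_+ edgeCount (deleteVertex G v)) deg≡1)))
                   edges)

module _ (P : ∀ {k} → Graph (3 + k) → Set)
         (cycle : ∀ {k} (G : Graph (3 + k)) → edgeCount G ≡ 3 + k → TwoRegular G → P G)
         (leaf : ∀ {k} (G : Graph (4 + k)) {v u} → Leaf G v u → P (deleteVertex G v) → P G) where

  mutual
    unicyclic-induction : ∀ k (G : Graph (3 + k)) → Connected G → edgeCount G ≡ 3 + k → P G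
    unicyclic-induction k G conn edges with any? (λ w → deg G w ℕ.≟ 1)
    ... | yes (v , deg≡1) = viaLeaf k G conn edges v deg≡1
    ... | no noLeaf = cycle G edges (∑-squeeze two≤deg ∑deg≤∑2)
      where
      two≤deg : ∀ w → 2 ≤ deg G w
      two≤deg w with deg G w in d | connected⇒deg≢0 G conn w
      ... | 0 | d≢0 = ⊥-elim (d≢0 refl)
      ... | 1 | _ = ⊥-elim (noLeaf (w , d))
      ... | suc (suc _) | _ = s≤s (s≤s z≤n)
      ∑deg≤∑2 : ∑[ w < 3 + k ] deg G w ≤ ∑[ w < 3 + k ] 2
      ∑deg≤∑2 = ≤-reflexive
        (trans (handshake G) (trans (cong₂ _+_ edges edges) (sym (∑-const-2 (3 + k)))))

    viaLeaf : ∀ k (G : Graph (3 + k)) → Connected G → edgeCount G ≡ 3 + k → ∀ v → deg G v ≡ 1 → P G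
    viaLeaf zero G conn edges v deg≡1 =
      ⊥-elim (two-vertex-edgeCount≢2 (deleteVertex G v) (deleteLeaf-edgeCount G v edges deg≡1))
    viaLeaf (suc k) G conn edges v deg≡1 =
      let u , v~u , unique = count≡1⇒unique (adj G v) deg≡1
          conn′ : Connected (deleteVertex G v)
          conn′ a b = shortcutLeaf (adj-sym G) unique (conn (punchIn v a) (punchIn v b)) refl refl
      in leaf G (record { adjacent = v~u ; unique = unique })
              (unicyclic-induction k (deleteVertex G v) conn′ (deleteLeaf-edgeCount G v edges deg≡1))

unicyclic⇒encoding : ∀ k (G : Graph (3 + k)) → Connected G → edgeCount G ≡ 3 + k →
                     PineappleEncoding G × (∀ w → EdgeAvoiding G w)
unicyclic⇒encoding = unicyclic-induction (λ G → PineappleEncoding G × (∀ w → EdgeAvoiding G w))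
  (λ G edges regular → cycleEncoding G edges regular , TwoRegular⇒EdgeAvoiding G regular)
  (λ G leaf (enc , avoiding) →
     LeafStep.encoding leaf avoiding enc , EdgeAvoiding-deleteVertex G _ avoiding)

module _ {k} {G : Graph (3 + k)} (enc : PineappleEncoding G) where

  open PineappleEncoding enc

  code : ConnSub G → Code k
  code x = encode (edgesOf x)

  code-edge : ∀ x → HasEdge (edgeAt x) → HasEdge (codeEdges (code x))
  code-edge x (a , b , ab) = nonempty-code⇒edge (code x) λ x↦0 →
    not-¬ ab (encode-injective (edgesOf x) noEdges
                (trans x↦0 (sym (encode-edgeless noEdges λ _ _ → refl))) a b)

  embed : (x : ConnSub G) → Dec (HasEdge (edgeAt x)) → ConnSub (pineapple (3 + k))
  embed x (yes e) = edgeSubgraph (decode (encode-conn (edgesOf x))) (code-edge x e)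
  embed x (no _) = vertexSubgraph (base x)

  embed-edges : ∀ x e → edgeAt (embed x (yes e)) ≐ codeEdges (code x)
  embed-edges x e = edgeAt-edgeSubgraph (decode (encode-conn (edgesOf x))) (code-edge x e)

  embed-injective : ∀ x y dx dy → proj₁ (embed x dx) ≡ proj₁ (embed y dy) → proj₁ x ≡ proj₁ y
  embed-injective x y (yes ex) (yes ey) eq =
    sameEdges⇒≡ x y ex (encode-injective (edgesOf x) (edgesOf y) sameCode)
    where
    sameCode : code x ≡ code y
    sameCode = codeEdges-injective (code x) (code y) λ i j →
      trans (sym (embed-edges x ex i j))
            (trans (edgeAt-cong (embed x (yes ex)) (embed y (yes ey)) eq i j) (embed-edges y ey i j))
  embed-injective x y (no nx) (no ny) eq =
    sameVertex⇒≡ x y (¬HasEdge⇒Edgeless nx) (¬HasEdge⇒Edgeless ny) (base-vertex x)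
      (subst (λ w → vertexAt y w ≡ true)
             (sym (vertexSubgraph-injective {G = pineapple (3 + k)} (base x) (base y) eq)) (base-vertex y))
  embed-injective x y (yes ex) (no ny) eq =
    ⊥-elim (edgeSubgraph≢vertexSubgraph (decode (encode-conn (edgesOf x))) (code-edge x ex) (base y) eq)
  embed-injective x y (no nx) (yes ey) eq =
    ⊥-elim (edgeSubgraph≢vertexSubgraph (decode (encode-conn (edgesOf y))) (code-edge y ey) (base x)
                                         (sym eq))

  embedding : G ≤F pineapple (3 + k)
  embedding = (λ x → embed x (hasEdge? (edgeAt x))) ,
              λ x y → embed-injective x y (hasEdge? (edgeAt x)) (hasEdge? (edgeAt y))

-- The hypothesis 4 ≤ n is only used to exclude n ≤ 2.
theorem4p6 : (n : ℕ) → 4 ≤ n → (G : Graph n) → Unicyclic G →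
    G ≤F pineapple n
theorem4p6 (suc (suc zero)) (s≤s (s≤s ())) _ _
theorem4p6 (suc (suc (suc k))) _ G (conn , numEdges≡n) =
  embedding (proj₁ (unicyclic⇒encoding k G conn (trans (sym (numEdges≡edgeCount G)) numEdges≡n)))
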